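{- Let $\mathbf{C}:\mathcal{C}\to\mathcal{B}$ be a 1-discrete 2-fibration. Let $f:A\to B$, $g:B\to C$, $h:A\to C$ be 1-cells in $\mathcal{B}$ and $\alpha:h\Rightarrow gf$ a 2-cell. Let $p:P\to Q$, $q:Q\to R$, $r:P\to R$ be 1-cells in $\mathcal{C}$ over $f,g,h$ respectively, and $\sigma:r\Rightarrow qp$ a 2-cell over $\alpha$. If $\alpha$ (and hence $\sigma$) is invertible and $q$ and $r$ are cartesian, then $p$ is cartesian.
   Context: A 2-functor is a strict homomorphism of 2-categories. A pre-2-fibration is a 2-functor $\mathbf{C}:\mathcal{C}\to\mathcal{B}$; cells of $\mathcal{C}$ lie over their images. It is a 1-discrete 2-fibration if (i) its underlying functor of 1-categories is a Grothendieck fibration, and (ii) for every 2-cell $\alpha:f\Rightarrow g$ in $\mathcal{B}$ and every 1-cell $p$ over $f$, there is a unique 2-cell over $\alpha$ with domain $p$. A 1-cell $q:Q\to R$ over $g$ is cartesian if for every 1-cell $r:P\to R$ over $g\circ f$ there is a unique $p:P\to Q$ over $f$ with $qp=r$. -}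

module Defs where

open import Level using (Level; _⊔_; suc)
open import Data.Product using (Σ; _×_; _,_; proj₂)
open import Relation.Binary.PropositionalEquality using (_≡_; subst₂)

∃!⟨_⟩ : ∀ {a p} {A : Set a} → (A → Set p) → Set (a ⊔ p)
∃!⟨ P ⟩ = Σ _ λ x → P x × (∀ y → P y → x ≡ y)

record TwoCategory (o h c : Level) : Set (suc (o ⊔ h ⊔ c)) where
  infixr 9 _∘_
  infixr 8 _·_
  infixr 7 _∗_
  field
    Obj  : Set o
    Hom  : Obj → Obj → Set h
    Cell : ∀ {A B} → Hom A B → Hom A B → Set c
    id₁  : ∀ {A} → Hom A A
    _∘_  : ∀ {A B C} → Hom B C → Hom A B → Hom A C
    ∘-assoc : ∀ {A B C D} (k : Hom C D) (g : Hom B C) (f : Hom A B) →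
              (k ∘ g) ∘ f ≡ k ∘ (g ∘ f)
    ∘-idˡ : ∀ {A B} (f : Hom A B) → id₁ ∘ f ≡ f
    ∘-idʳ : ∀ {A B} (f : Hom A B) → f ∘ id₁ ≡ f
    id₂  : ∀ {A B} {f : Hom A B} → Cell f f
    _·_  : ∀ {A B} {f g k : Hom A B} → Cell g k → Cell f g → Cell f k
    ·-assoc : ∀ {A B} {f g k l : Hom A B} (γ : Cell k l) (β : Cell g k) (α : Cell f g) →
              (γ · β) · α ≡ γ · (β · α)
    ·-idˡ : ∀ {A B} {f g : Hom A B} (α : Cell f g) → id₂ · α ≡ α
    ·-idʳ : ∀ {A B} {f g : Hom A B} (α : Cell f g) → α · id₂ ≡ α
    _∗_  : ∀ {A B C} {g g' : Hom B C} {f f' : Hom A B} →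
           Cell g g' → Cell f f' → Cell (g ∘ f) (g' ∘ f')
    ∗-id₂ : ∀ {A B C} {g : Hom B C} {f : Hom A B} → id₂ {f = g} ∗ id₂ {f = f} ≡ id₂
    interchange : ∀ {A B C} {g g' g'' : Hom B C} {f f' f'' : Hom A B}
                  (β' : Cell g' g'') (β : Cell g g') (α' : Cell f' f'') (α : Cell f f') →
                  (β' · β) ∗ (α' · α) ≡ (β' ∗ α') · (β ∗ α)
    ∗-assoc : ∀ {A B C D} {k k' : Hom C D} {g g' : Hom B C} {f f' : Hom A B}
              (γ : Cell k k') (β : Cell g g') (α : Cell f f') →
              subst₂ Cell (∘-assoc k g f) (∘-assoc k' g' f') ((γ ∗ β) ∗ α) ≡ γ ∗ (β ∗ α)
    ∗-idˡ : ∀ {A B} {f f' : Hom A B} (α : Cell f f') →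
            subst₂ Cell (∘-idˡ f) (∘-idˡ f') (id₂ {f = id₁} ∗ α) ≡ α
    ∗-idʳ : ∀ {A B} {f f' : Hom A B} (α : Cell f f') →
            subst₂ Cell (∘-idʳ f) (∘-idʳ f') (α ∗ id₂ {f = id₁}) ≡ α

  Invertible : ∀ {A B} {f g : Hom A B} → Cell f g → Set c
  Invertible {f = f} {g} α = Σ (Cell g f) λ β → (β · α ≡ id₂) × (α · β ≡ id₂)

  Total₁ : Set (o ⊔ h)
  Total₁ = Σ Obj λ X → Σ Obj λ Y → Hom X Y

  Total₂ : Set (o ⊔ h ⊔ c)
  Total₂ = Σ Obj λ X → Σ Obj λ Y → Σ (Hom X Y) λ u → Σ (Hom X Y) λ v → Cell u v

record TwoFunctor {o h c o' h' c'} (𝒞 : TwoCategory o h c) (ℬ : TwoCategory o' h' c')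
       : Set (o ⊔ h ⊔ c ⊔ o' ⊔ h' ⊔ c') where
  private
    module C = TwoCategory 𝒞
    module B = TwoCategory ℬ
  field
    F₀ : C.Obj → B.Obj
    F₁ : ∀ {X Y} → C.Hom X Y → B.Hom (F₀ X) (F₀ Y)
    F₂ : ∀ {X Y} {u v : C.Hom X Y} → C.Cell u v → B.Cell (F₁ u) (F₁ v)
    F-id₁ : ∀ {X} → F₁ (C.id₁ {X}) ≡ B.id₁
    F-∘   : ∀ {X Y Z} (v : C.Hom Y Z) (u : C.Hom X Y) → F₁ (v C.∘ u) ≡ F₁ v B.∘ F₁ u
    F-id₂ : ∀ {X Y} {u : C.Hom X Y} → F₂ (C.id₂ {f = u}) ≡ B.id₂
    F-·   : ∀ {X Y} {u v w : C.Hom X Y} (β : C.Cell v w) (α : C.Cell u v) →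
            F₂ (β C.· α) ≡ F₂ β B.· F₂ α
    F-∗   : ∀ {X Y Z} {v v' : C.Hom Y Z} {u u' : C.Hom X Y}
            (β : C.Cell v v') (α : C.Cell u u') →
            subst₂ B.Cell (F-∘ v u) (F-∘ v' u') (F₂ (β C.∗ α)) ≡ F₂ β B.∗ F₂ α

module PreTwoFibration {o h c o' h' c'} {𝒞 : TwoCategory o h c} {ℬ : TwoCategory o' h' c'}
       (F : TwoFunctor 𝒞 ℬ) where
  private
    module C = TwoCategory 𝒞
    module B = TwoCategory ℬ
  open TwoFunctor F

  -- a 1-cell p : P → Q of 𝒞 lies over f : A → B of ℬ
  -- (i.e. F₀ P = A, F₀ Q = B and F₁ p = f)
  LiesOver₁ : ∀ {P Q} → C.Hom P Q → ∀ {A B} → B.Hom A B → Set (o' ⊔ h')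
  LiesOver₁ {P} {Q} p {A} {B} f = _≡_ {A = B.Total₁} (F₀ P , F₀ Q , F₁ p) (A , B , f)

  LiesOver₂ : ∀ {P Q} {r s : C.Hom P Q} → C.Cell r s →
              ∀ {A B} {u v : B.Hom A B} → B.Cell u v → Set (o' ⊔ h' ⊔ c')
  LiesOver₂ {P} {Q} {r} {s} σ {A} {B} {u} {v} α =
    _≡_ {A = B.Total₂} (F₀ P , F₀ Q , F₁ r , F₁ s , F₂ σ) (A , B , u , v , α)

  IsCartesian : ∀ {Q R} → C.Hom Q R → ∀ {B C} → B.Hom B C → Set (o ⊔ h ⊔ o' ⊔ h')
  IsCartesian {Q} {R} q {B} {C} g =
    ∀ {P} {A} (f : B.Hom A B) (r : C.Hom P R) → LiesOver₁ r (g B.∘ f) →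
    ∃!⟨ (λ (p : C.Hom P Q) → LiesOver₁ p f × (q C.∘ p ≡ r)) ⟩

  record IsOneDiscreteTwoFibration : Set (o ⊔ h ⊔ c ⊔ o' ⊔ h' ⊔ c') where
    field
      cartesian-lift : ∀ (Q : C.Obj) {A} (f : B.Hom A (F₀ Q)) →
                       Σ C.Obj λ P → Σ (C.Hom P Q) λ p →
                         LiesOver₁ p f × IsCartesian p f
      cell-lift : ∀ {A B} {f g : B.Hom A B} (α : B.Cell f g)
                  {P Q} (p : C.Hom P Q) → LiesOver₁ p f →
                  ∃!⟨ (λ (x : Σ (C.Hom P Q) λ p' → C.Cell p p') →
                        LiesOver₂ (proj₂ x) α) ⟩

module Submission where

-- Let t : P' → Q lie over p ∘ f'.  Lift the 2-cell α⁻¹ f' to a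
-- 2-cell τ : q t ⇒ t'; then t' lies over r ∘ f'.  For v over f', pasting σ v
-- with τ yields a 2-cell over (α f')·(α⁻¹ f') = id or over (α⁻¹ f')·(α f') = id,
-- and in a 1-discrete 2-fibration a 2-cell over an identity has equal endpoints.
-- Hence p v = t iff r v = t' (the backward direction also uses that q is
-- cartesian), so the unique factorisation of t' through r is the unique
-- factorisation of t through p.

open import Defs
open import Level using (Level)
open import Relation.Binary.PropositionalEquality
  using (_≡_; refl; sym; trans; cong; cong₂; subst; subst₂; module ≡-Reasoning)
open import Data.Product using (_×_; _,_; proj₁; proj₂)

∃!-map : ∀ {a p q} {A : Set a} {P : A → Set p} {Q : A → Set q} →
         (∀ {x} → P x → Q x) → (∀ {x} → Q x → P x) → ∃!⟨ P ⟩ → ∃!⟨ Q ⟩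
∃!-map P⇒Q Q⇒P (x , Px , unique) = x , P⇒Q Px , λ y Qy → unique y (Q⇒P Qy)

module TwoCategoryProperties {o h c : Level} (D : TwoCategory o h c) where
  open TwoCategory D

  whiskerʳ-inverse : ∀ {A B C} {g g' : Hom B C} {f : Hom A B}
                     {α : Cell g g'} {β : Cell g' g} → β · α ≡ id₂ →
                     (β ∗ id₂ {f = f}) · (α ∗ id₂) ≡ id₂
  whiskerʳ-inverse {α = α} {β} β·α≡id = begin
    (β ∗ id₂) · (α ∗ id₂)  ≡⟨ sym (interchange β α id₂ id₂) ⟩
    (β · α) ∗ (id₂ · id₂)  ≡⟨ cong₂ _∗_ β·α≡id (·-idˡ id₂) ⟩
    id₂ ∗ id₂              ≡⟨ ∗-id₂ ⟩
    id₂                    ∎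
    where open ≡-Reasoning

  ⟪_⟫ : ∀ {A B} {u v : Hom A B} → Cell u v → Total₂
  ⟪_⟫ {A} {B} {u} {v} β = A , B , u , v , β

  dom₁ cod₁ : Total₂ → Total₁
  dom₁ (A , B , u , v , β) = A , B , u
  cod₁ (A , B , u , v , β) = A , B , v

  ⟪subst₂⟫ : ∀ {A B} {u u' v v' : Hom A B} (eu : u ≡ u') (ev : v ≡ v') (β : Cell u v) →
             ⟪ subst₂ Cell eu ev β ⟫ ≡ ⟪ β ⟫
  ⟪subst₂⟫ refl refl β = refl

  ⟪id₂⟫ : ∀ {A B A' B'} {u : Hom A B} {u' : Hom A' B'} →
          _≡_ {A = Total₁} (A , B , u) (A' , B' , u') → ⟪ id₂ {f = u} ⟫ ≡ ⟪ id₂ {f = u'} ⟫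
  ⟪id₂⟫ refl = refl

  ⟪·⟫ : ∀ {A B A' B'} {u v w : Hom A B} {u' v' w' : Hom A' B'}
        {β : Cell v w} {γ : Cell u v} {β' : Cell v' w'} {γ' : Cell u' v'} →
        ⟪ β ⟫ ≡ ⟪ β' ⟫ → ⟪ γ ⟫ ≡ ⟪ γ' ⟫ → ⟪ β · γ ⟫ ≡ ⟪ β' · γ' ⟫
  ⟪·⟫ refl refl = refl

  ⟪∗⟫ : ∀ {A B C A' B' C'} {g₁ g₂ : Hom B C} {f₁ f₂ : Hom A B}
        {g₁' g₂' : Hom B' C'} {f₁' f₂' : Hom A' B'}
        {β : Cell g₁ g₂} {γ : Cell f₁ f₂} {β' : Cell g₁' g₂'} {γ' : Cell f₁' f₂'} →
        ⟪ β ⟫ ≡ ⟪ β' ⟫ → ⟪ γ ⟫ ≡ ⟪ γ' ⟫ → ⟪ β ∗ γ ⟫ ≡ ⟪ β' ∗ γ' ⟫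
  ⟪∗⟫ refl refl = refl

module LiesOverProperties {o h c o' h' c'} {𝒞 : TwoCategory o h c} {ℬ : TwoCategory o' h' c'}
       (F : TwoFunctor 𝒞 ℬ) where
  private
    module C = TwoCategory 𝒞
    module B = TwoCategory ℬ
  open TwoFunctor F
  open PreTwoFibration F
  open TwoCategoryProperties ℬ

  over-≡ : ∀ {P Q} {x : C.Hom P Q} {A B} {f f' : B.Hom A B} → LiesOver₁ x f → f ≡ f' →
           LiesOver₁ x f'
  over-≡ x-over refl = x-over

  over-∘ : ∀ {P Q R} {x : C.Hom P Q} {y : C.Hom Q R} {A B C} {f : B.Hom A B} {g : B.Hom B C} →
           LiesOver₁ x f → LiesOver₁ y g → LiesOver₁ (y C.∘ x) (g B.∘ f)
  over-∘ {x = x} {y} refl refl = cong (λ u → _ , _ , u) (F-∘ y x)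

  over₂-≡ : ∀ {P Q} {r s : C.Hom P Q} {σ : C.Cell r s} {A B} {u v : B.Hom A B}
            {α α' : B.Cell u v} → LiesOver₂ σ α → α ≡ α' → LiesOver₂ σ α'
  over₂-≡ σ-over refl = σ-over

  over-dom : ∀ {P Q} {r s : C.Hom P Q} {σ : C.Cell r s} {A B} {u v : B.Hom A B}
             {α : B.Cell u v} → LiesOver₂ σ α → LiesOver₁ r u
  over-dom = cong dom₁

  over-cod : ∀ {P Q} {r s : C.Hom P Q} {σ : C.Cell r s} {A B} {u v : B.Hom A B}
             {α : B.Cell u v} → LiesOver₂ σ α → LiesOver₁ s v
  over-cod = cong cod₁

  over-subst : ∀ {P Q} {r s s' : C.Hom P Q} {σ : C.Cell r s} {A B} {u v : B.Hom A B}
               {α : B.Cell u v} (e : s ≡ s') → LiesOver₂ σ α → LiesOver₂ (subst (C.Cell r) e σ) α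
  over-subst refl σ-over = σ-over

  over-id₂ : ∀ {P Q} {x : C.Hom P Q} {A B} {f : B.Hom A B} →
             LiesOver₁ x f → LiesOver₂ (C.id₂ {f = x}) (B.id₂ {f = f})
  over-id₂ x-over = trans (cong ⟪_⟫ F-id₂) (⟪id₂⟫ x-over)

  over-· : ∀ {P Q} {r s t : C.Hom P Q} {σ : C.Cell s t} {τ : C.Cell r s}
           {A B} {u v w : B.Hom A B} {α : B.Cell v w} {β : B.Cell u v} →
           LiesOver₂ σ α → LiesOver₂ τ β → LiesOver₂ (σ C.· τ) (α B.· β)
  over-· {σ = σ} {τ} σ-over τ-over = trans (cong ⟪_⟫ (F-· σ τ)) (⟪·⟫ σ-over τ-over)

  over-∗ : ∀ {P Q R} {s s' : C.Hom Q R} {r r' : C.Hom P Q} {σ : C.Cell s s'} {τ : C.Cell r r'}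
           {A B C} {g g' : B.Hom B C} {f f' : B.Hom A B} {α : B.Cell g g'} {β : B.Cell f f'} →
           LiesOver₂ σ α → LiesOver₂ τ β → LiesOver₂ (σ C.∗ τ) (α B.∗ β)
  over-∗ {s = s} {s'} {r} {r'} {σ} {τ} σ-over τ-over = begin
    ⟪ F₂ (σ C.∗ τ) ⟫                                          ≡⟨ sym (⟪subst₂⟫ (F-∘ s r) (F-∘ s' r') _) ⟩
    ⟪ subst₂ B.Cell (F-∘ s r) (F-∘ s' r') (F₂ (σ C.∗ τ)) ⟫  ≡⟨ cong ⟪_⟫ (F-∗ σ τ) ⟩
    ⟪ F₂ σ B.∗ F₂ τ ⟫                                         ≡⟨ ⟪∗⟫ σ-over τ-over ⟩
    _                                                         ∎
    where open ≡-Reasoning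

module OneDiscreteTwoFibrationProperties
       {o h c o' h' c'} {𝒞 : TwoCategory o h c} {ℬ : TwoCategory o' h' c'}
       (F : TwoFunctor 𝒞 ℬ) (fib : PreTwoFibration.IsOneDiscreteTwoFibration F) where
  private
    module C = TwoCategory 𝒞
    module B = TwoCategory ℬ
  open TwoFunctor F
  open PreTwoFibration F
  open IsOneDiscreteTwoFibration fib
  open TwoCategoryProperties ℬ using (whiskerʳ-inverse)
  open LiesOverProperties F

  -- Both θ and id₂ are lifts of the identity with domain x, so they coincide.
  cod≡dom-over-id₂ : ∀ {P Q} {x z : C.Hom P Q} {θ : C.Cell x z} {A B} {f : B.Hom A B} →
                     LiesOver₂ θ (B.id₂ {f = f}) → z ≡ x
  cod≡dom-over-id₂ {x = x} {θ = θ} θ-over with cell-lift B.id₂ x (over-dom θ-over)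
  ... | _ , _ , unique =
    cong proj₁ (trans (sym (unique (_ , θ) θ-over)) (unique (x , C.id₂) (over-id₂ (over-dom θ-over))))

  cartesian-cancel : ∀ {Q R} {q : C.Hom Q R} {B C} {g : B.Hom B C} →
                     LiesOver₁ q g → IsCartesian q g →
                     ∀ {P A} {f : B.Hom A B} {x y : C.Hom P Q} →
                     LiesOver₁ x f → LiesOver₁ y f → q C.∘ x ≡ q C.∘ y → x ≡ y
  cartesian-cancel {q = q} q-over q-cart {f = f} {x} {y} x-over y-over qx≡qy
    with q-cart f (q C.∘ y) (over-∘ y-over q-over)
  ... | _ , _ , unique = trans (sym (unique x (x-over , qx≡qy))) (unique y (y-over , refl))

  module _ {P Q R} {p : C.Hom P Q} {q : C.Hom Q R} {r : C.Hom P R}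
           {σ : C.Cell r (q C.∘ p)} {α : B.Cell (F₁ r) (F₁ q B.∘ F₁ p)}
           (σ-over : LiesOver₂ σ α) (α-invertible : B.Invertible α) where
    private
      α⁻¹ = proj₁ α-invertible

    module _ {P' A'} {f' : B.Hom A' (F₀ P)} {t : C.Hom P' Q} {t' : C.Hom P' R}
             {τ : C.Cell (q C.∘ t) t'} (τ-over : LiesOver₂ τ (α⁻¹ B.∗ B.id₂ {f = f'}))
             {v : C.Hom P' P} (v-over : LiesOver₁ v f') where

      pv≡t⇒rv≡t' : p C.∘ v ≡ t → r C.∘ v ≡ t'
      pv≡t⇒rv≡t' pv≡t = sym (cod≡dom-over-id₂ θ-over)
        where
          qpv≡qt : (q C.∘ p) C.∘ v ≡ q C.∘ t
          qpv≡qt = trans (C.∘-assoc q p v) (cong (q C.∘_) pv≡t)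
          θ-over : LiesOver₂ (τ C.· subst (C.Cell (r C.∘ v)) qpv≡qt (σ C.∗ C.id₂ {f = v})) B.id₂
          θ-over = over₂-≡ (over-· τ-over (over-subst qpv≡qt (over-∗ σ-over (over-id₂ v-over))))
                           (whiskerʳ-inverse (proj₁ (proj₂ α-invertible)))

      rv≡t'⇒qpv≡qt : r C.∘ v ≡ t' → (q C.∘ p) C.∘ v ≡ q C.∘ t
      rv≡t'⇒qpv≡qt rv≡t' = cod≡dom-over-id₂ θ-over
        where
          θ-over : LiesOver₂ ((σ C.∗ C.id₂ {f = v}) C.· subst (C.Cell (q C.∘ t)) (sym rv≡t') τ) B.id₂
          θ-over = over₂-≡ (over-· (over-∗ σ-over (over-id₂ v-over)) (over-subst (sym rv≡t') τ-over))
                           (whiskerʳ-inverse (proj₂ (proj₂ α-invertible)))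

    factor-of-cartesian-is-cartesian : IsCartesian q (F₁ q) → IsCartesian r (F₁ r) →
                                       IsCartesian p (F₁ p)
    factor-of-cartesian-is-cartesian q-cart r-cart f' t t-over
      with cell-lift (α⁻¹ B.∗ B.id₂ {f = f'}) (q C.∘ t)
                     (over-≡ (over-∘ t-over refl) (sym (B.∘-assoc (F₁ q) (F₁ p) f')))
    ... | (t' , τ) , τ-over , _ = ∃!-map r-factor⇒p-factor p-factor⇒r-factor (r-cart f' t' (over-cod τ-over))
      where
        r-factor⇒p-factor : ∀ {v} → LiesOver₁ v f' × (r C.∘ v ≡ t') → LiesOver₁ v f' × (p C.∘ v ≡ t)
        r-factor⇒p-factor {v} (v-over , rv≡t') =
          v-over , cartesian-cancel refl q-cart (over-∘ v-over refl) t-over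
                     (trans (sym (C.∘-assoc q p v)) (rv≡t'⇒qpv≡qt τ-over v-over rv≡t'))
        p-factor⇒r-factor : ∀ {v} → LiesOver₁ v f' × (p C.∘ v ≡ t) → LiesOver₁ v f' × (r C.∘ v ≡ t')
        p-factor⇒r-factor (v-over , pv≡t) = v-over , pv≡t⇒rv≡t' τ-over v-over pv≡t

open OneDiscreteTwoFibrationProperties using (factor-of-cartesian-is-cartesian)

proposition4p2p5 : ∀ {o h c o' h' c'} {𝒞 : TwoCategory o h c} {ℬ : TwoCategory o' h' c'}
    (F : TwoFunctor 𝒞 ℬ) →
    PreTwoFibration.IsOneDiscreteTwoFibration F →
    ∀ {A B C} (f : TwoCategory.Hom ℬ A B) (g : TwoCategory.Hom ℬ B C) (h : TwoCategory.Hom ℬ A C)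
    (α : TwoCategory.Cell ℬ h (TwoCategory._∘_ ℬ g f)) →
    ∀ {P Q R} (p : TwoCategory.Hom 𝒞 P Q) (q : TwoCategory.Hom 𝒞 Q R) (r : TwoCategory.Hom 𝒞 P R)
    (σ : TwoCategory.Cell 𝒞 r (TwoCategory._∘_ 𝒞 q p)) →
    PreTwoFibration.LiesOver₁ F p f →
    PreTwoFibration.LiesOver₁ F q g →
    PreTwoFibration.LiesOver₁ F r h →
    PreTwoFibration.LiesOver₂ F σ α →
    TwoCategory.Invertible ℬ α →
    PreTwoFibration.IsCartesian F q g →
    PreTwoFibration.IsCartesian F r h →
    PreTwoFibration.IsCartesian F p f
proposition4p2p5 F fib f g h α p q r σ refl refl refl σ-over α-invertible q-cart r-cart =
  factor-of-cartesian-is-cartesian F fib σ-over α-invertible q-cart r-cart
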